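{- Let $G=(V,E)$ be a graph and $k$ an even positive integer such that $|V|\ge k+1$ and $|E|>(k-1)\bigl(|V|-\tfrac{k}{2}\bigr)$. Then $G$ contains a mixed $k$-connected subgraph.
   Context: For a graph $G=(V,E)$, a pair $(S,F)$ with $S\subseteq V$, $F\subseteq E$ is a mixed cut if $G-S-F$ is disconnected. $G$ is mixed $k$-connected if $2|S|+|F|\ge k$ for every mixed cut $(S,F)$ of $G$. -}

module Defs where

open import Data.Nat using (ℕ; _+_; _*_; _<_; _≤_)
open import Data.Nat.Properties using (_<?_)
open import Data.Bool using (Bool; true; false; _∧_; if_then_else_)
open import Data.Fin using (Fin; toℕ)
open import Data.List using (List; allFin; concatMap; filter; length; map)
open import Data.Product using (Σ; ∃; _×_; _,_)
open import Relation.Nullary.Decidable using (⌊_⌋)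
open import Relation.Binary.PropositionalEquality using (_≡_)

record Graph : Set where
  field
    n     : ℕ
    adj   : Fin n → Fin n → Bool
    sym   : ∀ i j → adj i j ≡ adj j i
    irrefl : ∀ i → adj i i ≡ false
open Graph public

countV : ∀ {n} → (Fin n → Bool) → ℕ
countV {n} P = length (filter (λ i → P i ≡? true) (allFin n))
  where
  open import Data.Bool.Properties using () renaming (_≟_ to _≡?_)

countPairs : ∀ {n} → (Fin n → Fin n → Bool) → ℕ
countPairs {n} R =
  length (filter (λ b → b ≡? true)
    (concatMap (λ i → map (λ j → ⌊ toℕ i <? toℕ j ⌋ ∧ R i j) (allFin n)) (allFin n)))
  where
  open import Data.Bool.Properties using () renaming (_≟_ to _≡?_)

edgeCount : Graph → ℕ
edgeCount G = countPairs (adj G)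

IsEdgeSet : (G : Graph) → (Fin (n G) → Fin (n G) → Bool) → Set
IsEdgeSet G F = (∀ i j → F i j ≡ F j i) × (∀ i j → F i j ≡ true → adj G i j ≡ true)

-- G - S - F is disconnected: the remaining vertices (those not in S) can be
-- split into two nonempty parts with no remaining edge (edge of G not in F)
-- between them.
Disconnected : (G : Graph) → (S : Fin (n G) → Bool) → (F : Fin (n G) → Fin (n G) → Bool) → Set
Disconnected G S F =
  Σ (Fin (n G) → Bool) λ A →
    (∃ λ u → S u ≡ false × A u ≡ true) ×
    (∃ λ v → S v ≡ false × A v ≡ false) ×
    (∀ i j → S i ≡ false → S j ≡ false → A i ≡ true → A j ≡ false →
       adj G i j ≡ true → F i j ≡ true)

IsMixedCut : (G : Graph) → (Fin (n G) → Bool) → (Fin (n G) → Fin (n G) → Bool) → Set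
IsMixedCut G S F = IsEdgeSet G F × Disconnected G S F

MixedConnected : ℕ → Graph → Set
MixedConnected k G =
  ∀ S F → IsMixedCut G S F → k ≤ 2 * countV S + countPairs F

SubgraphOf : Graph → Graph → Set
SubgraphOf H G =
  Σ (Fin (n H) → Fin (n G)) λ f →
    (∀ i j → f i ≡ f j → i ≡ j) ×
    (∀ i j → adj H i j ≡ true → adj G (f i) (f j) ≡ true)

-- Count edges twice (as arcs) and write k = c + 1.  Call a graph on m vertices overfull when it
-- has more than c (m - k/2) edges.  Shrinking an overfull graph on more than k vertices to a
-- minimal overfull induced subgraph on more than k vertices gives a critical graph: no proper
-- vertex set of size at least k induces an overfull graph (for size exactly k this holds anyway,
-- as k vertices span at most k (k - 1)/2 edges).  Deleting one vertex v shows deg v ≥ k.  If a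
-- mixed cut (S, F) with sides P and Q had 2|S| + |F| < k, then summing degrees over P gives
-- |P| + |S| > k, and likewise |Q| + |S| > k.  So S ∪ P and S ∪ Q are not overfull, while every
-- edge lies in one of them or in F; adding up, the edge count of G exceeds c (n - k/2) by at most
-- c |S| + |F| - c k/2 ≤ 0, a contradiction.  Evenness of k is only used to read k/2 in ℕ.
module Submission where

open import Defs
open import Data.Nat using (ℕ; _+_; _*_; _∸_; _/_; _<_; _≤_)
open import Data.Nat.Divisibility using (_∣_; divides)
open import Data.Product using (Σ; _×_; _,_; proj₁; proj₂)

open import Data.Bool using (Bool; true; false; not; _∧_; _∨_)
open import Data.Bool.Properties using (∧-zeroʳ) renaming (_≟_ to _≟ᵇ_)
open import Data.Fin using (Fin; zero; suc; toℕ)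
open import Data.Fin.Properties using (_≟_; suc-injective; toℕ-injective)
open import Data.Fin.Subset.Properties using (anySubset?)
open import Data.List using (List; []; _∷_; _++_; map; concatMap; filter; length; allFin)
import Data.List as List
open import Data.List.Properties using (map-++; map-tabulate)
open import Data.Nat using (zero; suc; z≤n; s≤s; >-nonZero)
open import Data.Nat.DivMod using (m*n/n≡m)
open import Data.Nat.Induction using (<-wellFounded)
open import Data.Nat.ListAction using () renaming (sum to listSum)
open import Data.Nat.ListAction.Properties using () renaming (sum-++ to listSum-++)
open import Data.Nat.Properties hiding (_≟_; suc-injective)
open import Algebra.Properties.Semiring.Sum +-*-semiring
  using (sum; ∑-distrib-+; ∑-comm; sum-cong-≗; sum-replicate-zero; *-distribʳ-sum)
open import Algebra.Properties.CommutativeSemigroup +-commutativeSemigroup using (xy∙z≈xz∙y)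
open import Data.Nat.Tactic.RingSolver using (solve-∀)
open import Data.Sum using (_⊎_; inj₁; inj₂)
import Data.Vec as Vec
open import Data.Vec.Properties using (lookup∘tabulate)
open import Data.Empty using (⊥-elim)
open import Function using (_∘_)
open import Induction.WellFounded using (Acc; acc)
open import Relation.Nullary using (Dec; contradiction)
open import Relation.Nullary.Decidable using (does; yes; no; ⌊_⌋; _×-dec_)
open import Relation.Binary.PropositionalEquality as ≡
  using (_≡_; refl; cong; cong₂; trans; subst; subst₂; module ≡-Reasoning)

-- Counting over Fin

𝟙 : Bool → ℕ
𝟙 true  = 1
𝟙 false = 0

count : ∀ {m} → (Fin m → Bool) → ℕ
count P = sum (λ i → 𝟙 (P i))

-- ordered pairs, so for the adjacency relation of a graph this is twice its number of edges
arcs : ∀ {m} → (Fin m → Fin m → Bool) → ℕ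
arcs R = sum (λ i → count (R i))

sum-mono-≤ : ∀ {m} {f g : Fin m → ℕ} → (∀ i → f i ≤ g i) → sum f ≤ sum g
sum-mono-≤ {zero}  f≤g = z≤n
sum-mono-≤ {suc m} f≤g = +-mono-≤ (f≤g zero) (sum-mono-≤ (λ i → f≤g (suc i)))

sum-const : ∀ m (x : ℕ) → sum {m} (λ _ → x) ≡ m * x
sum-const zero    x = refl
sum-const (suc m) x = cong (x +_) (sum-const m x)

count-true : ∀ m → count {m} (λ _ → true) ≡ m
count-true m = trans (sum-const m 1) (*-identityʳ m)

count≤ : ∀ {m} (P : Fin m → Bool) → count P ≤ m
count≤ {m} P = ≤-trans (sum-mono-≤ (λ i → 𝟙≤1 (P i))) (≤-reflexive (count-true m))
  where
  𝟙≤1 : ∀ b → 𝟙 b ≤ 1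
  𝟙≤1 true  = s≤s z≤n
  𝟙≤1 false = z≤n

count-pos : ∀ {m} (P : Fin m → Bool) {u} → P u ≡ true → 0 < count P
count-pos P {zero}  Pu rewrite Pu = s≤s z≤n
count-pos P {suc u} Pu = ≤-trans (count-pos (λ i → P (suc i)) Pu) (m≤n+m _ (𝟙 (P zero)))

count-cong : ∀ {m} {X Y : Fin m → Bool} → (∀ i → X i ≡ Y i) → count X ≡ count Y
count-cong X≗Y = sum-cong-≗ (λ i → cong 𝟙 (X≗Y i))

𝟙-cover₃ : ∀ {p a b c} → (p ≡ true → a ≡ true ⊎ b ≡ true ⊎ c ≡ true) → 𝟙 p ≤ 𝟙 a + 𝟙 b + 𝟙 c
𝟙-cover₃ {false} cover = z≤n
𝟙-cover₃ {true} {a} {b} {c} cover with cover refl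
... | inj₁ refl        = ≤-trans (m≤m+n 1 (𝟙 b)) (m≤m+n (1 + 𝟙 b) (𝟙 c))
... | inj₂ (inj₁ refl) = ≤-trans (m≤n+m 1 (𝟙 a)) (m≤m+n (𝟙 a + 1) (𝟙 c))
... | inj₂ (inj₂ refl) = m≤n+m 1 (𝟙 a + 𝟙 b)

count-cover₃ : ∀ {m} {P A B C : Fin m → Bool} →
  (∀ i → P i ≡ true → A i ≡ true ⊎ B i ≡ true ⊎ C i ≡ true) →
  count P ≤ count A + count B + count C
count-cover₃ {P = P} {A} {B} {C} cover = begin
  count P                                    ≤⟨ sum-mono-≤ (λ i → 𝟙-cover₃ (cover i)) ⟩
  sum (λ i → 𝟙 (A i) + 𝟙 (B i) + 𝟙 (C i))    ≡⟨ ∑-distrib-+ (λ i → 𝟙 (A i) + 𝟙 (B i)) _ ⟩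
  sum (λ i → 𝟙 (A i) + 𝟙 (B i)) + count C    ≡⟨ cong (_+ count C) (∑-distrib-+ (λ i → 𝟙 (A i)) _) ⟩
  count A + count B + count C                ∎
  where open ≤-Reasoning

arcs-cover₃ : ∀ {m} {R X Y Z : Fin m → Fin m → Bool} →
  (∀ i j → R i j ≡ true → X i j ≡ true ⊎ Y i j ≡ true ⊎ Z i j ≡ true) →
  arcs R ≤ arcs X + arcs Y + arcs Z
arcs-cover₃ {R = R} {X} {Y} {Z} cover = begin
  arcs R                                                ≤⟨ sum-mono-≤ (λ i → count-cover₃ (cover i)) ⟩
  sum (λ i → count (X i) + count (Y i) + count (Z i))   ≡⟨ ∑-distrib-+ (λ i → count (X i) + count (Y i)) _ ⟩
  sum (λ i → count (X i) + count (Y i)) + arcs Z        ≡⟨ cong (_+ arcs Z) (∑-distrib-+ (λ i → count (X i)) _) ⟩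
  arcs X + arcs Y + arcs Z                              ∎
  where open ≤-Reasoning

arcs-+-≤ : ∀ {m} {R R′ T : Fin m → Fin m → Bool} → (∀ i j → 𝟙 (R i j) + 𝟙 (R′ i j) ≤ 𝟙 (T i j)) →
  arcs R + arcs R′ ≤ arcs T
arcs-+-≤ {R = R} {R′} {T} pointwise = begin
  arcs R + arcs R′                                ≡⟨ ∑-distrib-+ (λ i → count (R i)) _ ⟨
  sum (λ i → count (R i) + count (R′ i))          ≡⟨ sum-cong-≗ (λ i → ∑-distrib-+ (λ j → 𝟙 (R i j)) _) ⟨
  sum (λ i → sum (λ j → 𝟙 (R i j) + 𝟙 (R′ i j)))  ≤⟨ sum-mono-≤ (λ i → sum-mono-≤ (pointwise i)) ⟩
  arcs T                                          ∎
  where open ≤-Reasoning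

-- `does` rather than `⌊_⌋`: only the former makes `suc i ≟ suc v` reduce to `i ≟ v`
count-≟ : ∀ {m} (v : Fin m) → count (λ i → does (i ≟ v)) ≡ 1
count-≟ {suc m} zero    = cong suc (sum-replicate-zero m)
count-≟ {suc m} (suc v) = count-≟ v

count-≟-∧ : ∀ {m} (v : Fin m) (P : Fin m → Bool) → count (λ i → does (i ≟ v) ∧ P i) ≡ 𝟙 (P v)
count-≟-∧ {suc m} zero    P = trans (cong (𝟙 (P zero) +_) (sum-replicate-zero m)) (+-identityʳ _)
count-≟-∧ {suc m} (suc v) P = count-≟-∧ v (λ i → P (suc i))

count-not : ∀ {m} (P : Fin m → Bool) → count (λ i → not (P i)) + count P ≡ m
count-not {m} P = begin
  count (λ i → not (P i)) + count P    ≡⟨ ∑-distrib-+ (λ i → 𝟙 (not (P i))) _ ⟨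
  sum (λ i → 𝟙 (not (P i)) + 𝟙 (P i))  ≡⟨ sum-cong-≗ (λ i → 𝟙-not (P i)) ⟩
  count {m} (λ _ → true)               ≡⟨ count-true m ⟩
  m                                    ∎
  where
  open ≡-Reasoning
  𝟙-not : ∀ b → 𝟙 (not b) + 𝟙 b ≡ 1
  𝟙-not true  = refl
  𝟙-not false = refl

count-∨ : ∀ {m} (P Q : Fin m → Bool) → count (λ i → P i ∨ Q i) ≡ count P + count (λ i → not (P i) ∧ Q i)
count-∨ P Q = trans (sum-cong-≗ (λ i → 𝟙-∨ (P i) (Q i))) (∑-distrib-+ (λ i → 𝟙 (P i)) _)
  where
  𝟙-∨ : ∀ p q → 𝟙 (p ∨ q) ≡ 𝟙 p + 𝟙 (not p ∧ q)
  𝟙-∨ true  q = refl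
  𝟙-∨ false q = refl

count-∨-disjoint : ∀ {m} (P Q : Fin m → Bool) → (∀ i → P i ≡ true → Q i ≡ false) →
  count (λ i → P i ∨ Q i) ≡ count P + count Q
count-∨-disjoint P Q disjoint =
  trans (sum-cong-≗ (λ i → 𝟙-∨ (P i) (Q i) (disjoint i))) (∑-distrib-+ (λ i → 𝟙 (P i)) _)
  where
  𝟙-∨ : ∀ p q → (p ≡ true → q ≡ false) → 𝟙 (p ∨ q) ≡ 𝟙 p + 𝟙 q
  𝟙-∨ true  q p⇒¬q rewrite p⇒¬q refl = refl
  𝟙-∨ false q _ = refl

count-trichotomy : ∀ {m} (S A : Fin m → Bool) →
  m ≡ count S + count (λ i → not (S i) ∧ A i) + count (λ i → not (S i) ∧ not (A i))
count-trichotomy {m} S A = begin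
  m                        ≡⟨ count-true m ⟨
  count {m} (λ _ → true)   ≡⟨ sum-cong-≗ (λ i → split (S i) (A i)) ⟩
  sum (λ i → 𝟙 (S i) + 𝟙 (not (S i) ∧ A i) + 𝟙 (not (S i) ∧ not (A i)))
                           ≡⟨ ∑-distrib-+ (λ i → 𝟙 (S i) + 𝟙 (not (S i) ∧ A i)) _ ⟩
  sum (λ i → 𝟙 (S i) + 𝟙 (not (S i) ∧ A i)) + count (λ i → not (S i) ∧ not (A i))
                           ≡⟨ cong (_+ count (λ i → not (S i) ∧ not (A i))) (∑-distrib-+ (λ i → 𝟙 (S i)) _) ⟩
  count S + count (λ i → not (S i) ∧ A i) + count (λ i → not (S i) ∧ not (A i)) ∎
  where
  open ≡-Reasoning
  split : ∀ s a → 1 ≡ 𝟙 s + 𝟙 (not s ∧ a) + 𝟙 (not s ∧ not a)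
  split true  a     = refl
  split false true  = refl
  split false false = refl

𝟙*count : ∀ {m} b (P : Fin m → Bool) → 𝟙 b * count P ≡ count (λ j → b ∧ P j)
𝟙*count {m} true  P = +-identityʳ (count P)
𝟙*count {m} false P = ≡.sym (sum-replicate-zero m)

count*-≤ : ∀ {m} (P : Fin m → Bool) {x y : ℕ} (g : Fin m → ℕ) → (∀ v → P v ≡ true → x ≤ y + g v) →
  count P * x ≤ count P * y + sum (λ v → 𝟙 (P v) * g v)
count*-≤ P {x} {y} g bound = begin
  count P * x                                          ≡⟨ *-distribʳ-sum x (λ v → 𝟙 (P v)) ⟩
  sum (λ v → 𝟙 (P v) * x)                              ≤⟨ sum-mono-≤ (λ v → pointwise (P v) (bound v)) ⟩
  sum (λ v → 𝟙 (P v) * y + 𝟙 (P v) * g v)              ≡⟨ ∑-distrib-+ (λ v → 𝟙 (P v) * y) _ ⟩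
  sum (λ v → 𝟙 (P v) * y) + sum (λ v → 𝟙 (P v) * g v)  ≡⟨ cong (_+ _) (*-distribʳ-sum y (λ v → 𝟙 (P v))) ⟨
  count P * y + sum (λ v → 𝟙 (P v) * g v)              ∎
  where
  open ≤-Reasoning
  pointwise : ∀ {z} b → (b ≡ true → x ≤ y + z) → 𝟙 b * x ≤ 𝟙 b * y + 𝟙 b * z
  pointwise true  x≤y+z =
    subst₂ _≤_ (≡.sym (+-identityʳ x)) (≡.sym (cong₂ _+_ (+-identityʳ y) (+-identityʳ _))) (x≤y+z refl)
  pointwise false _     = z≤n

arcs-transpose : ∀ {m} (R : Fin m → Fin m → Bool) → arcs (λ i j → R j i) ≡ arcs R
arcs-transpose R = ≡.sym (∑-comm (λ i j → 𝟙 (R i j)))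

arcs-row : ∀ {m} (v : Fin m) (R : Fin m → Fin m → Bool) → arcs (λ i j → does (i ≟ v) ∧ R i j) ≡ count (R v)
arcs-row v R = trans (∑-comm (λ i j → 𝟙 (does (i ≟ v) ∧ R i j))) (sum-cong-≗ (λ j → count-≟-∧ v (λ i → R i j)))

arcs-column : ∀ {m} (v : Fin m) (R : Fin m → Fin m → Bool) →
  arcs (λ i j → does (j ≟ v) ∧ R i j) ≡ count (λ i → R i v)
arcs-column v R = sum-cong-≗ (λ i → count-≟-∧ v (R i))

crossing-arcs : ∀ {m} (P Q : Fin m → Bool) (F : Fin m → Fin m → Bool) →
  (∀ i j → F i j ≡ F j i) → (∀ i → P i ≡ true → Q i ≡ false) →
  2 * arcs (λ i j → P i ∧ Q j ∧ F i j) ≤ arcs F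
crossing-arcs {m} P Q F F-sym disjoint = begin
  2 * arcs PQ          ≡⟨ cong (arcs PQ +_) (+-identityʳ (arcs PQ)) ⟩
  arcs PQ + arcs PQ    ≡⟨ cong (arcs PQ +_) reverse ⟨
  arcs PQ + arcs QP    ≤⟨ arcs-+-≤ pointwise ⟩
  arcs F               ∎
  where
  open ≤-Reasoning
  PQ QP : Fin m → Fin m → Bool
  PQ i j = P i ∧ Q j ∧ F i j
  QP i j = Q i ∧ P j ∧ F i j
  ∧-swap : ∀ x y z → x ∧ (y ∧ z) ≡ y ∧ (x ∧ z)
  ∧-swap true  y z = refl
  ∧-swap false y z = ≡.sym (∧-zeroʳ y)
  reverse : arcs QP ≡ arcs PQ
  reverse = trans (sum-cong-≗ (λ i → count-cong (λ j → trans (cong (λ x → Q i ∧ P j ∧ x) (F-sym i j))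
                                                             (∧-swap (Q i) (P j) (F j i)))))
                  (arcs-transpose PQ)
  𝟙-∧-≤ : ∀ a b → 𝟙 (a ∧ b) ≤ 𝟙 b
  𝟙-∧-≤ true  b = ≤-refl
  𝟙-∧-≤ false b = z≤n
  pointwise : ∀ i j → 𝟙 (PQ i j) + 𝟙 (QP i j) ≤ 𝟙 (F i j)
  pointwise i j with P i in Pi
  ... | true rewrite disjoint i Pi = ≤-trans (≤-reflexive (+-identityʳ _)) (𝟙-∧-≤ (Q j) (F i j))
  ... | false = ≤-trans (𝟙-∧-≤ (Q i) _) (𝟙-∧-≤ (P j) (F i j))

length-filter-≡true : ∀ {A : Set} (f : A → Bool) xs →
  length (filter (λ x → f x ≟ᵇ true) xs) ≡ listSum (map (λ x → 𝟙 (f x)) xs)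
length-filter-≡true f []       = refl
length-filter-≡true f (x ∷ xs) with f x
... | true  = cong suc (length-filter-≡true f xs)
... | false = length-filter-≡true f xs

listSum-map-concatMap : ∀ {A B : Set} (g : B → ℕ) (φ : A → List B) xs →
  listSum (map g (concatMap φ xs)) ≡ listSum (map (λ x → listSum (map g (φ x))) xs)
listSum-map-concatMap g φ []       = refl
listSum-map-concatMap g φ (x ∷ xs) = begin
  listSum (map g (φ x ++ concatMap φ xs))
    ≡⟨ cong listSum (map-++ g (φ x) _) ⟩
  listSum (map g (φ x) ++ map g (concatMap φ xs))
    ≡⟨ listSum-++ (map g (φ x)) _ ⟩
  listSum (map g (φ x)) + listSum (map g (concatMap φ xs))
    ≡⟨ cong (listSum (map g (φ x)) +_) (listSum-map-concatMap g φ xs) ⟩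
  listSum (map (λ x → listSum (map g (φ x))) (x ∷ xs))
    ∎
  where open ≡-Reasoning

listSum-map-tabulate : ∀ {m} {A : Set} (f : Fin m → A) (g : A → ℕ) →
  listSum (map g (List.tabulate f)) ≡ sum (λ i → g (f i))
listSum-map-tabulate {zero}  f g = refl
listSum-map-tabulate {suc m} f g = cong (g (f zero) +_) (listSum-map-tabulate (λ i → f (suc i)) g)

countV≡count : ∀ {m} (P : Fin m → Bool) → countV P ≡ count P
countV≡count {m} P = trans (length-filter-≡true P (allFin m)) (listSum-map-tabulate (λ i → i) (λ i → 𝟙 (P i)))

_<ᵇ_ : ∀ {m} → Fin m → Fin m → Bool
i <ᵇ j = ⌊ toℕ i <? toℕ j ⌋

countPairs≡arcs : ∀ {m} (R : Fin m → Fin m → Bool) → countPairs R ≡ arcs (λ i j → i <ᵇ j ∧ R i j)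
countPairs≡arcs {m} R = begin
  countPairs R
    ≡⟨ length-filter-≡true (λ b → b) (concatMap row (allFin m)) ⟩
  listSum (map 𝟙 (concatMap row (allFin m)))
    ≡⟨ listSum-map-concatMap 𝟙 row (allFin m) ⟩
  listSum (map (λ i → listSum (map 𝟙 (row i))) (allFin m))
    ≡⟨ listSum-map-tabulate (λ i → i) (λ i → listSum (map 𝟙 (row i))) ⟩
  sum (λ i → listSum (map 𝟙 (row i)))
    ≡⟨ sum-cong-≗ row-count ⟩
  arcs (λ i j → i <ᵇ j ∧ R i j)
    ∎
  where
  open ≡-Reasoning
  row : Fin m → List Bool
  row i = map (λ j → i <ᵇ j ∧ R i j) (allFin m)
  row-count : ∀ i → listSum (map 𝟙 (row i)) ≡ count (λ j → i <ᵇ j ∧ R i j)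
  row-count i = trans (cong (λ xs → listSum (map 𝟙 xs)) (map-tabulate (λ j → j) (λ j → i <ᵇ j ∧ R i j)))
                      (listSum-map-tabulate (λ j → i <ᵇ j ∧ R i j) 𝟙)

arcs≡2*countPairs : ∀ {m} (R : Fin m → Fin m → Bool) → (∀ i j → R i j ≡ R j i) → (∀ i → R i i ≡ false) →
  arcs R ≡ 2 * countPairs R
arcs≡2*countPairs {m} R symmetric irreflexive = begin
  arcs R
    ≡⟨ sum-cong-≗ (λ i → trans (sum-cong-≗ (split i)) (∑-distrib-+ (λ j → 𝟙 (R< i j)) _)) ⟩
  sum (λ i → count (R< i) + count (λ j → R< j i))
    ≡⟨ ∑-distrib-+ (λ i → count (R< i)) _ ⟩
  arcs R< + arcs (λ i j → R< j i)
    ≡⟨ cong (arcs R< +_) (trans (arcs-transpose R<) (≡.sym (+-identityʳ _))) ⟩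
  2 * arcs R<
    ≡⟨ cong (2 *_) (countPairs≡arcs R) ⟨
  2 * countPairs R
    ∎
  where
  open ≡-Reasoning
  R< : Fin m → Fin m → Bool
  R< i j = i <ᵇ j ∧ R i j
  split : ∀ i j → 𝟙 (R i j) ≡ 𝟙 (R< i j) + 𝟙 (R< j i)
  split i j with toℕ i <? toℕ j | toℕ j <? toℕ i
  ... | yes i<j | yes j<i = ⊥-elim (<-asym i<j j<i)
  ... | yes _   | no _    = ≡.sym (+-identityʳ _)
  ... | no _    | yes _   = cong 𝟙 (symmetric i j)
  ... | no i≮j  | no j≮i with toℕ-injective (≤-antisym (≮⇒≥ j≮i) (≮⇒≥ i≮j))
  ...   | refl rewrite irreflexive i = refl

arcs-edgeSet : (G : Graph) (F : Fin (n G) → Fin (n G) → Bool) → IsEdgeSet G F → arcs F ≡ 2 * countPairs F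
arcs-edgeSet G F (F-sym , F⊆E) = arcs≡2*countPairs F F-sym F-irreflexive
  where
  F-irreflexive : ∀ i → F i i ≡ false
  F-irreflexive i with F i i in Fii
  ... | true  = contradiction (trans (≡.sym (F⊆E i i Fii)) (irrefl G i)) λ ()
  ... | false = refl

-- Degrees and induced subgraphs

degree : (G : Graph) → Fin (n G) → ℕ
degree G v = count (adj G v)

count-closedNeighbourhood : (G : Graph) (v : Fin (n G)) →
  count (λ j → does (j ≟ v) ∨ adj G v j) ≡ 1 + degree G v
count-closedNeighbourhood G v =
  trans (count-∨-disjoint (λ j → does (j ≟ v)) (adj G v) v≢j) (cong (_+ degree G v) (count-≟ v))
  where
  v≢j : ∀ j → does (j ≟ v) ≡ true → adj G v j ≡ false
  v≢j j j≡v with j ≟ v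
  v≢j j j≡v | yes refl = irrefl G j

handshake-bound : (G : Graph) → n G + arcs (adj G) ≤ n G * n G
handshake-bound G = begin
  n G + arcs (adj G)                                  ≡⟨ cong (_+ arcs (adj G)) (count-true (n G)) ⟨
  count {n G} (λ _ → true) + arcs (adj G)             ≡⟨ ∑-distrib-+ (λ _ → 1) (degree G) ⟨
  sum (λ v → 1 + degree G v)                          ≡⟨ sum-cong-≗ (count-closedNeighbourhood G) ⟨
  sum (λ v → count (closed v))                        ≤⟨ sum-mono-≤ (λ v → count≤ (closed v)) ⟩
  sum {n G} (λ _ → n G)                               ≡⟨ sum-const (n G) (n G) ⟩
  n G * n G                                           ∎
  where
  open ≤-Reasoning
  closed : Fin (n G) → Fin (n G) → Bool
  closed v j = does (j ≟ v) ∨ adj G v j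

enum : ∀ {m} (X : Fin m → Bool) → Fin (count X) → Fin m
enum {suc m} X = cons (X zero) (enum (λ i → X (suc i)))
  where
  cons : ∀ {k} (b : Bool) → (Fin k → Fin m) → Fin (𝟙 b + k) → Fin (suc m)
  cons true  e zero    = zero
  cons true  e (suc i) = suc (e i)
  cons false e i       = suc (e i)

enum-injective : ∀ {m} (X : Fin m → Bool) {i j} → enum X i ≡ enum X j → i ≡ j
enum-injective {suc m} X {i} {j} eq with X zero
enum-injective X {zero}  {zero}  eq | true  = refl
enum-injective X {suc i} {suc j} eq | true  = cong suc (enum-injective (λ i → X (suc i)) (suc-injective eq))
enum-injective X {i}     {j}     eq | false = enum-injective (λ i → X (suc i)) (suc-injective eq)

sum-enum : ∀ {m} (X : Fin m → Bool) (g : Fin m → ℕ) → sum (λ i → 𝟙 (X i) * g i) ≡ sum (λ i → g (enum X i))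
sum-enum {zero}  X g = refl
sum-enum {suc m} X g with X zero
... | true  = cong₂ _+_ (+-identityʳ (g zero)) (sum-enum (λ i → X (suc i)) (λ i → g (suc i)))
... | false = sum-enum (λ i → X (suc i)) (λ i → g (suc i))

induced : (G : Graph) → (Fin (n G) → Bool) → Graph
induced G X = record
  { n      = count X
  ; adj    = λ i j → adj G (enum X i) (enum X j)
  ; sym    = λ i j → Graph.sym G (enum X i) (enum X j)
  ; irrefl = λ i → irrefl G (enum X i)
  }

subgraph-refl : (G : Graph) → SubgraphOf G G
subgraph-refl G = (λ i → i) , (λ i j e → e) , (λ i j e → e)

subgraph-trans : ∀ {H K G} → SubgraphOf H K → SubgraphOf K G → SubgraphOf H G
subgraph-trans (f , f-inj , f-adj) (g , g-inj , g-adj) =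
  (λ i → g (f i)) , (λ i j e → f-inj i j (g-inj (f i) (f j) e)) , (λ i j e → g-adj (f i) (f j) (f-adj i j e))

induced-subgraph : (G : Graph) (X : Fin (n G) → Bool) → SubgraphOf (induced G X) G
induced-subgraph G X = enum X , (λ i j → enum-injective X) , (λ i j e → e)

arcsIn : (G : Graph) → (Fin (n G) → Bool) → ℕ
arcsIn G X = arcs (λ i j → X i ∧ X j ∧ adj G i j)

arcsIn-cong : (G : Graph) {X Y : Fin (n G) → Bool} → (∀ i → X i ≡ Y i) → arcsIn G X ≡ arcsIn G Y
arcsIn-cong G X≗Y = sum-cong-≗ (λ i → count-cong (λ j → cong₂ (λ x y → x ∧ y ∧ adj G i j) (X≗Y i) (X≗Y j)))

arcs-induced : (G : Graph) (X : Fin (n G) → Bool) → arcs (adj (induced G X)) ≡ arcsIn G X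
arcs-induced G X = ≡.sym (begin
  sum (λ i → count (λ j → X i ∧ X j ∧ adj G i j))
    ≡⟨ sum-cong-≗ (λ i → 𝟙*count (X i) (λ j → X j ∧ adj G i j)) ⟨
  sum (λ i → 𝟙 (X i) * count (λ j → X j ∧ adj G i j))
    ≡⟨ sum-enum X (λ i → count (λ j → X j ∧ adj G i j)) ⟩
  sum (λ i → count (λ j → X j ∧ adj G (enum X i) j))
    ≡⟨ sum-cong-≗ (λ i → sum-cong-≗ (λ j → 𝟙-∧ (X j) (adj G (enum X i) j))) ⟩
  sum (λ i → sum (λ j → 𝟙 (X j) * 𝟙 (adj G (enum X i) j)))
    ≡⟨ sum-cong-≗ (λ i → sum-enum X (λ j → 𝟙 (adj G (enum X i) j))) ⟩
  arcs (adj (induced G X))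
    ∎)
  where
  open ≡-Reasoning
  𝟙-∧ : ∀ b p → 𝟙 (b ∧ p) ≡ 𝟙 b * 𝟙 p
  𝟙-∧ true  p = ≡.sym (+-identityʳ (𝟙 p))
  𝟙-∧ false p = refl

arcsIn-handshake : (G : Graph) (Y : Fin (n G) → Bool) → count Y + arcsIn G Y ≤ count Y * count Y
arcsIn-handshake G Y = subst (λ e → count Y + e ≤ count Y * count Y) (arcs-induced G Y) (handshake-bound (induced G Y))

-- Overfull graphs: the arithmetic

-- m vertices and e arcs with e/2 > c (m - (c + 1)/2), doubled to stay in ℕ
Overfull : ℕ → ℕ → ℕ → Set
Overfull c m e = 2 * c * m < e + c * suc c

threshold-arith : ∀ c e → suc c + e ≤ suc c * suc c → e + c * suc c ≤ 2 * c * suc c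
threshold-arith c e handshake = begin
  e + c * suc c          ≤⟨ +-monoˡ-≤ (c * suc c) (+-cancelˡ-≤ (suc c) e (c * suc c) handshake) ⟩
  c * suc c + c * suc c  ≡⟨ cong (c * suc c +_) (+-identityʳ (c * suc c)) ⟨
  2 * (c * suc c)        ≡⟨ *-assoc 2 c (suc c) ⟨
  2 * c * suc c          ∎
  where open ≤-Reasoning

bound⇒overfull : ∀ c h m e → suc c ≡ h * 2 → h ≤ m → c * (m ∸ h) < e → Overfull c m (2 * e)
bound⇒overfull c h m e k≡2h h≤m edges = begin-strict
  2 * c * m                      ≡⟨ cong (2 * c *_) (m∸n+n≡m h≤m) ⟨
  2 * c * (m ∸ h + h)            ≡⟨ *-distribˡ-+ (2 * c) (m ∸ h) h ⟩
  2 * c * (m ∸ h) + 2 * c * h    ≡⟨ cong (_+ 2 * c * h) (*-assoc 2 c (m ∸ h)) ⟩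
  2 * (c * (m ∸ h)) + 2 * c * h  <⟨ +-monoˡ-< (2 * c * h) (*-monoʳ-< 2 edges) ⟩
  2 * e + 2 * c * h              ≡⟨ cong (2 * e +_) (trans (reorder c h) (cong (c *_) (≡.sym k≡2h))) ⟩
  2 * e + c * suc c              ∎
  where
  open ≤-Reasoning
  reorder : ∀ c h → 2 * c * h ≡ c * (h * 2)
  reorder = solve-∀

degree-arith : ∀ c m e e′ d → Overfull c (suc m) e → e ≤ e′ + d + d → e′ + c * suc c ≤ 2 * c * m → c < d
degree-arith c m e e′ d overfull cover sparse =
  *-cancelˡ-< 2 c d (+-cancelˡ-< (2 * c * m) (2 * c) (2 * d) (begin-strict
    2 * c * m + 2 * c           ≡⟨ trans (*-suc (2 * c) m) (+-comm (2 * c) (2 * c * m)) ⟨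
    2 * c * suc m               <⟨ overfull ⟩
    e + c * suc c               ≤⟨ +-monoˡ-≤ (c * suc c) cover ⟩
    e′ + d + d + c * suc c      ≡⟨ regroup e′ d (c * suc c) ⟩
    e′ + c * suc c + 2 * d      ≤⟨ +-monoˡ-≤ (2 * d) sparse ⟩
    2 * c * m + 2 * d           ∎))
  where
  open ≤-Reasoning
  regroup : ∀ e′ d K → e′ + d + d + K ≡ e′ + K + 2 * d
  regroup = solve-∀

side-arith : ∀ a s k r f → a * suc k ≤ a * (a + s) + r → r ≤ f → 2 * s + f < k → 0 < a → k < a + s
side-arith a s k r f weighted r≤f small 0<a with k <? a + s
... | yes k<a+s = k<a+s
... | no  k≮a+s with m≤n⇒∃[o]m+o≡n (≮⇒≥ k≮a+s)
...   | d , refl = ⊥-elim (<-irrefl refl (begin-strict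
  f                ≤⟨ m≤n+m f s ⟩
  s + f            <⟨ +-cancelˡ-< s (s + f) (a + d) (subst₂ _<_ (shuffle₁ s f) (shuffle₂ a s d) small) ⟩
  a + d            ≤⟨ +-monoʳ-≤ a (m≤n*m d a {{>-nonZero 0<a}}) ⟩
  a + a * d        ≡⟨ *-suc a d ⟨
  a * suc d        ≤⟨ +-cancelˡ-≤ (a * (a + s)) _ _ (subst (_≤ a * (a + s) + r) (split a s d) weighted) ⟩
  r                ≤⟨ r≤f ⟩
  f                ∎))
  where
  open ≤-Reasoning
  shuffle₁ : ∀ s f → 2 * s + f ≡ s + (s + f)
  shuffle₁ = solve-∀
  shuffle₂ : ∀ a s d → a + s + d ≡ s + (a + d)
  shuffle₂ = solve-∀
  split : ∀ a s d → a * suc (a + s + d) ≡ a * (a + s) + a * suc d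
  split = solve-∀

cut-arith : ∀ c s a b e e₁ e₂ f → Overfull c (s + a + b) e → e ≤ e₁ + e₂ + 2 * f →
  e₁ + c * suc c ≤ 2 * c * (s + a) → e₂ + c * suc c ≤ 2 * c * (s + b) → c * suc c < 2 * c * s + 2 * f
cut-arith c s a b e e₁ e₂ f overfull cover sparse₁ sparse₂ = +-cancelˡ-< (2 * c * (s + a + b)) _ _ (begin-strict
  2 * c * (s + a + b) + K                    <⟨ +-monoˡ-< K overfull ⟩
  e + K + K                                  ≤⟨ +-monoˡ-≤ K (+-monoˡ-≤ K cover) ⟩
  e₁ + e₂ + 2 * f + K + K                    ≡⟨ regroup e₁ e₂ f K ⟩
  (e₁ + K) + (e₂ + K) + 2 * f                ≤⟨ +-monoˡ-≤ (2 * f) (+-mono-≤ sparse₁ sparse₂) ⟩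
  2 * c * (s + a) + 2 * c * (s + b) + 2 * f  ≡⟨ collect c s a b f ⟩
  2 * c * (s + a + b) + (2 * c * s + 2 * f)  ∎)
  where
  open ≤-Reasoning
  K = c * suc c
  regroup : ∀ e₁ e₂ f K → e₁ + e₂ + 2 * f + K + K ≡ (e₁ + K) + (e₂ + K) + 2 * f
  regroup = solve-∀
  collect : ∀ c s a b f → 2 * c * (s + a) + 2 * c * (s + b) + 2 * f ≡ 2 * c * (s + a + b) + (2 * c * s + 2 * f)
  collect = solve-∀

small-cut-arith : ∀ c s f → 2 * s + f < suc c → 2 * c * s + 2 * f ≤ c * suc c
small-cut-arith c s f small = begin
  2 * c * s + 2 * f          ≡⟨ expand c s f ⟩
  c * (2 * s) + (f + f)      ≤⟨ +-monoʳ-≤ (c * (2 * s)) (f+f≤c*f+c f (≤-trans (m≤n+m f (2 * s)) 2s+f≤c)) ⟩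
  c * (2 * s) + (c * f + c)  ≡⟨ factor c s f ⟩
  c * (2 * s + f) + c        ≤⟨ +-monoˡ-≤ c (*-monoʳ-≤ c 2s+f≤c) ⟩
  c * c + c                  ≡⟨ trans (*-suc c c) (+-comm c (c * c)) ⟨
  c * suc c                  ∎
  where
  open ≤-Reasoning
  2s+f≤c : 2 * s + f ≤ c
  2s+f≤c = ≤-pred small
  f+f≤c*f+c : ∀ f → f ≤ c → f + f ≤ c * f + c
  f+f≤c*f+c zero    _   = z≤n
  f+f≤c*f+c (suc f) f<c = +-mono-≤ (m≤n*m (suc f) c {{>-nonZero (≤-trans (s≤s z≤n) f<c)}}) f<c
  expand : ∀ c s f → 2 * c * s + 2 * f ≡ c * (2 * s) + (f + f)
  expand = solve-∀
  factor : ∀ c s f → c * (2 * s) + (c * f + c) ≡ c * (2 * s + f) + c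
  factor = solve-∀

-- Critical graphs are mixed connected

Critical : ℕ → Graph → Set
Critical c G = ∀ Y → count Y < n G → suc c ≤ count Y → arcsIn G Y + c * suc c ≤ 2 * c * count Y

threshold-sparse : ∀ c (G : Graph) (Y : Fin (n G) → Bool) → suc c ≡ count Y →
  arcsIn G Y + c * suc c ≤ 2 * c * count Y
threshold-sparse c G Y k≡|Y| = subst (λ m → arcsIn G Y + c * suc c ≤ 2 * c * m) k≡|Y|
  (threshold-arith c (arcsIn G Y) (subst (λ m → m + arcsIn G Y ≤ m * m) (≡.sym k≡|Y|) (arcsIn-handshake G Y)))

critical⇒minDegree : ∀ c (G : Graph) → suc c < n G → Overfull c (n G) (arcs (adj G)) → Critical c G →
  ∀ v → suc c ≤ degree G v
critical⇒minDegree c G large overfull critical v =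
  degree-arith c (count Y) (arcs (adj G)) (arcsIn G Y) (degree G v)
    (subst (λ m → Overfull c m (arcs (adj G))) n≡1+|Y| overfull)
    cover
    (critical Y (≤-reflexive (≡.sym n≡1+|Y|)) (≤-pred (subst (suc c <_) n≡1+|Y| large)))
  where
  Y : Fin (n G) → Bool
  Y i = not (does (i ≟ v))
  n≡1+|Y| : n G ≡ suc (count Y)
  n≡1+|Y| = trans (≡.sym (count-not (λ i → does (i ≟ v)))) (trans (cong (count Y +_) (count-≟ v)) (+-comm (count Y) 1))
  incident : ∀ i j → adj G i j ≡ true →
    (Y i ∧ Y j ∧ adj G i j) ≡ true ⊎ (does (i ≟ v) ∧ adj G i j) ≡ true ⊎ (does (j ≟ v) ∧ adj G i j) ≡ true
  incident i j e with i ≟ v | j ≟ v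
  ... | yes _ | _     = inj₂ (inj₁ e)
  ... | no _  | yes _ = inj₂ (inj₂ e)
  ... | no _  | no _  = inj₁ e
  cover : arcs (adj G) ≤ arcsIn G Y + degree G v + degree G v
  cover = ≤-trans (arcs-cover₃ incident)
    (≤-reflexive (cong₂ (λ x y → arcsIn G Y + x + y) (arcs-row v (adj G))
                        (trans (arcs-column v (adj G)) (count-cong (λ i → Graph.sym G i v)))))

-- Each v ∈ P has its closed neighbourhood inside P ∪ S ∪ (its F-neighbours in Q), so summing
-- k + 1 ≤ 1 + deg v over P bounds |P| (k + 1) by |P| (|P| + |S|) plus the F-arcs from P to Q.
large-side : ∀ c (G : Graph) (S P Q : Fin (n G) → Bool) (F : Fin (n G) → Fin (n G) → Bool) {f} →
  (∀ v → suc c ≤ degree G v) →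
  (∀ j → P j ≡ true ⊎ S j ≡ true ⊎ Q j ≡ true) →
  (∀ i j → P i ≡ true → Q j ≡ true → adj G i j ≡ true → F i j ≡ true) →
  arcs (λ i j → P i ∧ Q j ∧ F i j) ≤ f →
  0 < count P → 2 * count S + f < suc c → suc c < count P + count S
large-side c G S P Q F {f} minDegree partition separated crossing nonempty small =
  side-arith (count P) (count S) (suc c) (arcs (λ i j → P i ∧ Q j ∧ F i j)) f weighted crossing small nonempty
  where
  closed-cover : ∀ v → P v ≡ true → ∀ j → (does (j ≟ v) ∨ adj G v j) ≡ true →
    P j ≡ true ⊎ S j ≡ true ⊎ (Q j ∧ F v j) ≡ true
  closed-cover v Pv j e with j ≟ v
  ... | yes refl = inj₁ Pv
  ... | no _ with partition j
  ...   | inj₁ Pj        = inj₁ Pj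
  ...   | inj₂ (inj₁ Sj) = inj₂ (inj₁ Sj)
  ...   | inj₂ (inj₂ Qj) rewrite Qj = inj₂ (inj₂ (separated v j Pv Qj e))
  local-bound : ∀ v → P v ≡ true → suc (suc c) ≤ count P + count S + count (λ j → Q j ∧ F v j)
  local-bound v Pv = begin
    suc (suc c)                                    ≤⟨ s≤s (minDegree v) ⟩
    suc (degree G v)                               ≡⟨ count-closedNeighbourhood G v ⟨
    count (λ j → does (j ≟ v) ∨ adj G v j)         ≤⟨ count-cover₃ (closed-cover v Pv) ⟩
    count P + count S + count (λ j → Q j ∧ F v j)  ∎
    where open ≤-Reasoning
  weighted : count P * suc (suc c) ≤ count P * (count P + count S) + arcs (λ i j → P i ∧ Q j ∧ F i j)
  weighted = subst (λ r → count P * suc (suc c) ≤ count P * (count P + count S) + r)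
    (sum-cong-≗ (λ v → 𝟙*count (P v) (λ j → Q j ∧ F v j)))
    (count*-≤ P (λ v → count (λ j → Q j ∧ F v j)) local-bound)

Separation : (G : Graph) (S A : Fin (n G) → Bool) → (Fin (n G) → Fin (n G) → Bool) → Set
Separation G S A F =
  ∀ i j → S i ≡ false → S j ≡ false → A i ≡ true → A j ≡ false → adj G i j ≡ true → F i j ≡ true

separation-cover : (G : Graph) (S A : Fin (n G) → Bool) (F : Fin (n G) → Fin (n G) → Bool) →
  (∀ i j → F i j ≡ F j i) → Separation G S A F →
  arcs (adj G) ≤ arcsIn G (λ i → S i ∨ A i) + arcsIn G (λ i → S i ∨ not (A i)) + arcs F
separation-cover G S A F F-sym separates = arcs-cover₃ edge
  where
  edge : ∀ i j → adj G i j ≡ true →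
    ((S i ∨ A i) ∧ (S j ∨ A j) ∧ adj G i j) ≡ true ⊎
    ((S i ∨ not (A i)) ∧ (S j ∨ not (A j)) ∧ adj G i j) ≡ true ⊎ F i j ≡ true
  edge i j e with S i in Si | S j in Sj | A i in Ai | A j in Aj
  ... | true  | true  | _     | _     = inj₁ e
  ... | true  | false | _     | true  = inj₁ e
  ... | true  | false | _     | false = inj₂ (inj₁ e)
  ... | false | true  | true  | _     = inj₁ e
  ... | false | true  | false | _     = inj₂ (inj₁ e)
  ... | false | false | true  | true  = inj₁ e
  ... | false | false | false | false = inj₂ (inj₁ e)
  ... | false | false | true  | false = inj₂ (inj₂ (separates i j Si Sj Ai Aj e))
  ... | false | false | false | true  =
    inj₂ (inj₂ (trans (F-sym i j) (separates j i Sj Si Aj Ai (trans (Graph.sym G j i) e))))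

small-cut⇒large-sides : ∀ c (G : Graph) (S A : Fin (n G) → Bool) (F : Fin (n G) → Fin (n G) → Bool) →
  (∀ v → suc c ≤ degree G v) → IsEdgeSet G F → Separation G S A F →
  0 < count (λ i → not (S i) ∧ A i) → 0 < count (λ i → not (S i) ∧ not (A i)) →
  2 * count S + countPairs F < suc c →
  suc c < count (λ i → not (S i) ∧ A i) + count S × suc c < count (λ i → not (S i) ∧ not (A i)) + count S
small-cut⇒large-sides c G S A F minDegree (F-sym , F⊆E) separates P≢∅ Q≢∅ small =
  large-side c G S P Q F minDegree partition separated (crossing P Q P∩Q=∅) P≢∅ small ,
  large-side c G S Q P F minDegree (swap ∘ partition) separated′ (crossing Q P Q∩P=∅) Q≢∅ small
  where
  P Q : Fin (n G) → Bool
  P i = not (S i) ∧ A i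
  Q i = not (S i) ∧ not (A i)
  partition : ∀ j → P j ≡ true ⊎ S j ≡ true ⊎ Q j ≡ true
  partition j with S j | A j
  ... | true  | _     = inj₂ (inj₁ refl)
  ... | false | true  = inj₁ refl
  ... | false | false = inj₂ (inj₂ refl)
  swap : ∀ {X Y Z : Set} → X ⊎ Y ⊎ Z → Z ⊎ Y ⊎ X
  swap (inj₁ x)        = inj₂ (inj₂ x)
  swap (inj₂ (inj₁ y)) = inj₂ (inj₁ y)
  swap (inj₂ (inj₂ z)) = inj₁ z
  P∩Q=∅ : ∀ i → P i ≡ true → Q i ≡ false
  P∩Q=∅ i Pi with S i | A i
  ... | false | true = refl
  Q∩P=∅ : ∀ i → Q i ≡ true → P i ≡ false
  Q∩P=∅ i Qi with S i | A i
  ... | false | false = refl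
  separated : ∀ i j → P i ≡ true → Q j ≡ true → adj G i j ≡ true → F i j ≡ true
  separated i j Pi Qj with S i in Si | A i in Ai | S j in Sj | A j in Aj
  ... | false | true | false | false = separates i j Si Sj Ai Aj
  separated′ : ∀ i j → Q i ≡ true → P j ≡ true → adj G i j ≡ true → F i j ≡ true
  separated′ i j Qi Pj e = trans (F-sym i j) (separated j i Pj Qi (trans (Graph.sym G j i) e))
  crossing : ∀ X Z → (∀ i → X i ≡ true → Z i ≡ false) → arcs (λ i j → X i ∧ Z j ∧ F i j) ≤ countPairs F
  crossing X Z disjoint = *-cancelˡ-≤ 2 (≤-trans (crossing-arcs X Z F F-sym disjoint)
                                                 (≤-reflexive (arcs-edgeSet G F (F-sym , F⊆E))))

critical⇒mixedConnected : ∀ c (G : Graph) → suc c < n G → Overfull c (n G) (arcs (adj G)) → Critical c G →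
  MixedConnected (suc c) G
critical⇒mixedConnected c G large overfull critical S F (F∈E , A , (u , Su , Au) , (v , Sv , Av) , separates)
  with suc c ≤? 2 * countV S + countPairs F
... | yes k≤cut = k≤cut
... | no  k≰cut = contradiction (small-cut-arith c s f small)
  (<⇒≱ (cut-arith c s a b (arcs (adj G)) (arcsIn G Y₁) (arcsIn G Y₂) f
          (subst (λ m → Overfull c m (arcs (adj G))) n≡s+a+b overfull) cover
          (sparse Y₁ (count-∨ S A) n≡s+a+b Q≢∅ (proj₁ sides))
          (sparse Y₂ (count-∨ S (λ i → not (A i))) (trans n≡s+a+b (xy∙z≈xz∙y s a b)) P≢∅ (proj₂ sides))))
  where
  P Q Y₁ Y₂ : Fin (n G) → Bool
  P i = not (S i) ∧ A i
  Q i = not (S i) ∧ not (A i)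
  Y₁ i = S i ∨ A i
  Y₂ i = S i ∨ not (A i)
  s = count S
  a = count P
  b = count Q
  f = countPairs F
  small : 2 * s + f < suc c
  small = subst (λ x → 2 * x + f < suc c) (countV≡count S) (≰⇒> k≰cut)
  n≡s+a+b : n G ≡ s + a + b
  n≡s+a+b = count-trichotomy S A
  P≢∅ : 0 < a
  P≢∅ = count-pos P (subst (λ x → not x ∧ A u ≡ true) (≡.sym Su) Au)
  Q≢∅ : 0 < b
  Q≢∅ = count-pos Q (subst₂ (λ x y → not x ∧ not y ≡ true) (≡.sym Sv) (≡.sym Av) refl)
  sides : suc c < a + s × suc c < b + s
  sides = small-cut⇒large-sides c G S A F (critical⇒minDegree c G large overfull critical) F∈E separates
            P≢∅ Q≢∅ small
  sparse : ∀ Y {x y} → count Y ≡ s + x → n G ≡ s + x + y → 0 < y → suc c < x + s →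
    arcsIn G Y + c * suc c ≤ 2 * c * (s + x)
  sparse Y {x} |Y| n≡ 0<y k<x+s = subst (λ m → arcsIn G Y + c * suc c ≤ 2 * c * m) |Y|
    (critical Y (subst₂ _<_ (≡.sym |Y|) (≡.sym n≡) (m<m+n (s + x) 0<y))
                (≤-trans (<⇒≤ k<x+s) (≤-reflexive (trans (+-comm x s) (≡.sym |Y|)))))
  cover : arcs (adj G) ≤ arcsIn G Y₁ + arcsIn G Y₂ + 2 * f
  cover = ≤-trans (separation-cover G S A F (proj₁ F∈E) separates)
                  (≤-reflexive (cong (arcsIn G Y₁ + arcsIn G Y₂ +_) (arcs-edgeSet G F F∈E)))

-- Finding a critical subgraph

anyVertexSet? : ∀ {m} {P : (Fin m → Bool) → Set} → (∀ Y → Dec (P Y)) →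
  (∀ {X Y} → (∀ i → X i ≡ Y i) → P X → P Y) → Dec (Σ (Fin m → Bool) P)
anyVertexSet? P? respects with anySubset? (λ p → P? (Vec.lookup p))
... | yes (p , Pp) = yes (Vec.lookup p , Pp)
... | no  ∄p       = no λ (Y , PY) → ∄p (Vec.tabulate Y , respects (λ i → ≡.sym (lookup∘tabulate Y i)) PY)

OverfullPart : ℕ → (G : Graph) → (Fin (n G) → Bool) → Set
OverfullPart c G Y = count Y < n G × suc c < count Y × Overfull c (count Y) (arcsIn G Y)

overfullPart-or-critical : ∀ c (G : Graph) → Σ (Fin (n G) → Bool) (OverfullPart c G) ⊎ Critical c G
overfullPart-or-critical c G with anyVertexSet? overfullPart? respects
  where
  overfullPart? : ∀ Y → Dec (OverfullPart c G Y)
  overfullPart? Y = count Y <? n G ×-dec suc c <? count Y ×-dec 2 * c * count Y <? arcsIn G Y + c * suc c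
  respects : ∀ {X Y} → (∀ i → X i ≡ Y i) → OverfullPart c G X → OverfullPart c G Y
  respects X≗Y rewrite count-cong X≗Y | arcsIn-cong G X≗Y = λ part → part
... | yes overfullPart  = inj₁ overfullPart
... | no  ∄overfullPart = inj₂ critical
  where
  critical : Critical c G
  critical Y Y<n k≤Y with m≤n⇒m<n∨m≡n k≤Y
  ... | inj₁ k<Y   = ≮⇒≥ (λ overfull → ∄overfullPart (Y , Y<n , k<Y , overfull))
  ... | inj₂ k≡|Y| = threshold-sparse c G Y k≡|Y|

overfull⇒mixedConnectedSubgraph : ∀ c (G : Graph) → suc c < n G → Overfull c (n G) (arcs (adj G)) →
  Σ Graph λ H → suc c < n H × SubgraphOf H G × MixedConnected (suc c) H
overfull⇒mixedConnectedSubgraph c G = go G (<-wellFounded (n G))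
  where
  go : ∀ G → Acc _<_ (n G) → suc c < n G → Overfull c (n G) (arcs (adj G)) →
    Σ Graph λ H → suc c < n H × SubgraphOf H G × MixedConnected (suc c) H
  go G (acc smaller) large overfull with overfullPart-or-critical c G
  ... | inj₂ critical = G , large , subgraph-refl G , critical⇒mixedConnected c G large overfull critical
  ... | inj₁ (Y , Y<n , k<Y , overfullY)
    with go (induced G Y) (smaller Y<n) k<Y (subst (Overfull c (count Y)) (≡.sym (arcs-induced G Y)) overfullY)
  ...   | H , k<H , H⊆G[Y] , connected =
    H , k<H , subgraph-trans {H} {induced G Y} {G} H⊆G[Y] (induced-subgraph G Y) , connected

theorem5p5 : (G : Graph) (k : ℕ) → 2 ∣ k → 0 < k →
    k + 1 ≤ n G →
    (k ∸ 1) * (n G ∸ k / 2) < edgeCount G →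
    Σ Graph λ H → 2 ≤ n H × SubgraphOf H G × MixedConnected k H
theorem5p5 G .(suc h′ * 2) (divides (suc h′) refl) _ k+1≤n edges
  with overfull⇒mixedConnectedSubgraph (suc (h′ * 2)) G large overfull
  where
  h = suc h′
  large : h * 2 < n G
  large = subst (_≤ n G) (+-comm (h * 2) 1) k+1≤n
  overfull : Overfull (suc (h′ * 2)) (n G) (arcs (adj G))
  overfull = subst (Overfull (suc (h′ * 2)) (n G)) (≡.sym (arcs≡2*countPairs (adj G) (Graph.sym G) (irrefl G)))
    (bound⇒overfull (suc (h′ * 2)) h (n G) (edgeCount G) refl (≤-trans (m≤m*n h 2) (<⇒≤ large))
      (subst (λ x → suc (h′ * 2) * (n G ∸ x) < edgeCount G) (m*n/n≡m h 2) edges))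
... | H , k<H , H⊆G , connected = H , ≤-trans (s≤s (s≤s z≤n)) k<H , H⊆G , connected
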